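{- Let $\Delta$ be a pure simplicial complex. If $\Delta$ is ridge-chordal and $\dim\Delta=\dim\operatorname{Cl}(\Delta)$, then $\Delta$ has at least one free ridge.
   Context: Simplicial complexes are on vertex set $[n]$. For a pure $d$-dimensional complex $\Delta$, a ridge is a $(d-1)$-dimensional face. A clique of $\Delta$ is a subset $V\subseteq[n]$ such that every subset of $V$ of size $d+1$ is a facet of $\Delta$; $\operatorname{Cl}(\Delta)$ is the simplicial complex whose faces are the cliques of $\Delta$. $\Delta$ is ridge-chordal if it can be reduced to the empty set by repeatedly deleting a ridge $r$ (removing all faces containing $r$) such that the set of vertices of the star of $r$ (the subcomplex generated by facets containing $r$) in the current complex is a clique of the current complex. A free face is a face strictly contained in exactly one facet; a free ridge is a ridge that is a free face. -}

module Defs where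

open import Data.Nat using (ℕ; suc; _≤_; _<_)
open import Data.Bool using (Bool; T; _∧_; not)
open import Data.Fin using (Fin)
open import Data.Fin.Subset using (Subset; _⊆_; _⊂_; _∈_; ∣_∣)
open import Data.Fin.Subset.Properties using (_⊆?_)
open import Data.Product using (Σ; ∃; _×_)
open import Relation.Nullary using (¬_)
open import Relation.Nullary.Decidable using (⌊_⌋)
open import Relation.Binary.PropositionalEquality using (_≡_)

Faces : ℕ → Set
Faces n = Subset n → Bool

module _ {n : ℕ} where

  Face : Faces n → Subset n → Set
  Face K σ = T (K σ)

  IsSimplicialComplex : Faces n → Set
  IsSimplicialComplex K = ∀ σ τ → τ ⊆ σ → Face K σ → Face K τ

  IsFacet : Faces n → Subset n → Set
  IsFacet K σ = Face K σ × (∀ τ → Face K τ → σ ⊆ τ → τ ≡ σ)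

  IsPure : Faces n → Set
  IsPure K = ∀ σ τ → IsFacet K σ → IsFacet K τ → ∣ σ ∣ ≡ ∣ τ ∣

  HasDim : ℕ → (Subset n → Set) → Set
  HasDim d P = (∃ λ σ → P σ × ∣ σ ∣ ≡ suc d) × (∀ σ → P σ → ∣ σ ∣ ≤ suc d)

  IsClique : ℕ → Faces n → Subset n → Set
  IsClique d K V = ∀ σ → σ ⊆ V → ∣ σ ∣ ≡ suc d → IsFacet K σ

  Cl : ℕ → Faces n → Subset n → Set
  Cl d K V = IsClique d K V

  IsCliqueP : ℕ → Faces n → (Fin n → Set) → Set
  IsCliqueP d K P = ∀ σ → (∀ v → v ∈ σ → P v) → ∣ σ ∣ ≡ suc d → IsFacet K σ

  IsRidge : ℕ → Faces n → Subset n → Set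
  IsRidge d K r = Face K r × ∣ r ∣ ≡ d

  StarVertices : Faces n → Subset n → Fin n → Set
  StarVertices K r v = ∃ λ F → IsFacet K F × r ⊆ F × v ∈ F

  deleteFace : Faces n → Subset n → Faces n
  deleteFace K r σ = K σ ∧ not ⌊ r ⊆? σ ⌋

  -- ridge-chordality (for a complex of dimension d): repeatedly delete a
  -- ridge whose star's vertex set is a clique, until no ridge (hence no
  -- face of dimension ≥ d-1) is left.
  data RidgeChordalFrom (d : ℕ) : Faces n → Set where
    done : ∀ {K} → (∀ σ → Face K σ → ∣ σ ∣ < d) → RidgeChordalFrom d K
    step : ∀ {K} (r : Subset n) → IsRidge d K r →
           IsCliqueP d K (StarVertices K r) →
           RidgeChordalFrom d (deleteFace K r) → RidgeChordalFrom d K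

  IsFreeFace : Faces n → Subset n → Set
  IsFreeFace K σ = Face K σ × (∃ λ F → IsFacet K F × σ ⊂ F ×
                     (∀ G → IsFacet K G → σ ⊂ G → G ≡ F))

  IsFreeRidge : ℕ → Faces n → Subset n → Set
  IsFreeRidge d K r = IsRidge d K r × IsFreeFace K r

module Submission where

-- Ridge-chordality provides a first ridge r to delete: a ridge whose
-- star has a clique as vertex set.  We show that r is a free ridge.
--   * Since Δ is pure of dimension d, r lies in a facet F with d+1
--     vertices (otherwise r itself would be a facet of the wrong size).
--   * For any facet G ⊇ r, F ∪ G lies in the vertex set of the star of r,
--     hence is a clique; as Cl(Δ) has dimension d, ∣F ∪ G∣ ≤ d+1 = ∣F∣,
--     so G ⊆ F and, both being facets, G = F.

open import Defs
open import Data.Nat using (ℕ; suc; _≤_; _<_)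
open import Data.Nat.Properties using (<-irrefl; <-trans; <⇒≱; ≤-pred; ≤∧≢⇒<; n≮n; n<1+n; _≟_)
open import Data.Bool.Properties using (T?)
open import Data.Fin.Subset using (Subset; _⊆_; _⊂_; _∈_; ∣_∣; _∪_)
open import Data.Fin.Subset.Properties
  using (_∈?_; _⊂?_; _⊆?_; ⊆-antisym; p⊂q⇒∣p∣<∣q∣; p⊆p∪q; q⊆p∪q; x∈p∪q⁻; anySubset?)
open import Data.Product using (∃; _×_; _,_; proj₁; proj₂)
open import Data.Sum using (_⊎_; inj₁; inj₂; [_,_])
open import Data.Empty using (⊥-elim)
open import Relation.Nullary using (¬_; yes; no; _×-dec_)
open import Relation.Binary.PropositionalEquality using (_≡_; refl; sym; subst; subst₂; module ≡-Reasoning)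

module _ {n : ℕ} where

  ⊆⇒≡⊎⊂ : {p q : Subset n} → p ⊆ q → p ≡ q ⊎ p ⊂ q
  ⊆⇒≡⊎⊂ {p} {q} p⊆q with p ⊂? q
  ... | yes p⊂q = inj₂ p⊂q
  ... | no p⊄q  = inj₁ (⊆-antisym p⊆q q⊆p)
    where
      q⊆p : q ⊆ p
      q⊆p {x} x∈q with x ∈? p
      ... | yes x∈p = x∈p
      ... | no x∉p  = ⊥-elim (p⊄q (p⊆q , x , x∈q , x∉p))

  ⊆-card-≥⇒≡ : {p q : Subset n} → p ⊆ q → ∣ q ∣ ≤ ∣ p ∣ → p ≡ q
  ⊆-card-≥⇒≡ p⊆q ∣q∣≤∣p∣ with ⊆⇒≡⊎⊂ p⊆q
  ... | inj₁ p≡q = p≡q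
  ... | inj₂ p⊂q = ⊥-elim (<⇒≱ (p⊂q⇒∣p∣<∣q∣ p⊂q) ∣q∣≤∣p∣)

  ⊆-card-<⇒⊂ : {p q : Subset n} → p ⊆ q → ∣ p ∣ < ∣ q ∣ → p ⊂ q
  ⊆-card-<⇒⊂ p⊆q ∣p∣<∣q∣ with ⊆⇒≡⊎⊂ p⊆q
  ... | inj₁ refl = ⊥-elim (n≮n _ ∣p∣<∣q∣)
  ... | inj₂ p⊂q = p⊂q

module _ {n : ℕ} {d : ℕ} {Δ : Faces n} where

  top-face-is-facet : HasDim d (Face Δ) → {τ : Subset n} →
                      Face Δ τ → ∣ τ ∣ ≡ suc d → IsFacet Δ τ
  top-face-is-facet (_ , bound) {τ} τ∈Δ ∣τ∣≡d+1 = τ∈Δ , λ σ σ∈Δ τ⊆σ →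
    sym (⊆-card-≥⇒≡ τ⊆σ (subst (∣ σ ∣ ≤_) (sym ∣τ∣≡d+1) (bound σ σ∈Δ)))

  has-large-face : HasDim d (Face Δ) → ¬ (∀ σ → Face Δ σ → ∣ σ ∣ < d)
  has-large-face ((σ , σ∈Δ , ∣σ∣≡d+1) , _) small =
    n≮n d (<-trans (n<1+n d) (subst (_< d) ∣σ∣≡d+1 (small σ σ∈Δ)))

  isolated-ridge-is-facet : HasDim d (Face Δ) → {r : Subset n} → IsRidge d Δ r →
    ¬ (∃ λ τ → Face Δ τ × r ⊆ τ × ∣ τ ∣ ≡ suc d) → IsFacet Δ r
  isolated-ridge-is-facet (_ , bound) {r} (r∈Δ , ∣r∣≡d) isolated =
    r∈Δ , λ τ τ∈Δ r⊆τ → sym (⊆-card-≥⇒≡ r⊆τ (coface-small τ τ∈Δ r⊆τ))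
    where
      coface-small : ∀ τ → Face Δ τ → r ⊆ τ → ∣ τ ∣ ≤ ∣ r ∣
      coface-small τ τ∈Δ r⊆τ with ∣ τ ∣ ≟ suc d
      ... | yes ∣τ∣≡d+1 = ⊥-elim (isolated (τ , τ∈Δ , r⊆τ , ∣τ∣≡d+1))
      ... | no ∣τ∣≢d+1 =
        subst (∣ τ ∣ ≤_) (sym ∣r∣≡d) (≤-pred (≤∧≢⇒< (bound τ τ∈Δ) ∣τ∣≢d+1))

  -- In a pure complex of dimension d every ridge lies in a facet with
  -- d+1 vertices: otherwise it would be a facet with only d vertices.
  ridge-in-top-facet : IsPure Δ → HasDim d (Face Δ) → {r : Subset n} → IsRidge d Δ r →
    ∃ λ F → IsFacet Δ F × r ⊆ F × ∣ F ∣ ≡ suc d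
  ridge-in-top-facet pure dimΔ@((σ , σ∈Δ , ∣σ∣≡d+1) , _) {r} ridge@(_ , ∣r∣≡d)
    with anySubset? (λ τ → T? (Δ τ) ×-dec ((r ⊆? τ) ×-dec (∣ τ ∣ ≟ suc d)))
  ... | yes (F , F∈Δ , r⊆F , ∣F∣≡d+1) =
    F , top-face-is-facet dimΔ F∈Δ ∣F∣≡d+1 , r⊆F , ∣F∣≡d+1
  ... | no isolated = ⊥-elim (<-irrefl d≡d+1 (n<1+n d))
    where
      d≡d+1 : d ≡ suc d
      d≡d+1 = begin
        d        ≡⟨ sym ∣r∣≡d ⟩
        ∣ r ∣    ≡⟨ pure r σ (isolated-ridge-is-facet dimΔ ridge isolated)
                             (top-face-is-facet dimΔ σ∈Δ ∣σ∣≡d+1) ⟩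
        ∣ σ ∣    ≡⟨ ∣σ∣≡d+1 ⟩
        suc d    ∎
        where open ≡-Reasoning

  star-union-is-clique : {r F G : Subset n} → IsCliqueP d Δ (StarVertices Δ r) →
    IsFacet Δ F → r ⊆ F → IsFacet Δ G → r ⊆ G → Cl d Δ (F ∪ G)
  star-union-is-clique {r} {F} {G} starClique F-facet r⊆F G-facet r⊆G σ σ⊆F∪G =
    starClique σ (λ v v∈σ → [ in-F v , in-G v ] (x∈p∪q⁻ F G (σ⊆F∪G v∈σ)))
    where
      in-F : ∀ v → v ∈ F → StarVertices Δ r v
      in-F v v∈F = F , F-facet , r⊆F , v∈F
      in-G : ∀ v → v ∈ G → StarVertices Δ r v
      in-G v v∈G = G , G-facet , r⊆G , v∈G

  -- If cliques have at most d+1 vertices and the star of r has a clique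
  -- as vertex set, then a facet F ⊇ r with d+1 vertices is the only facet
  -- containing r: for a facet G ⊇ r, the clique F ∪ G is no larger than F.
  clique-star-unique-facet : HasDim d (Cl d Δ) → {r F G : Subset n} →
    IsCliqueP d Δ (StarVertices Δ r) → IsFacet Δ F → r ⊆ F → ∣ F ∣ ≡ suc d →
    IsFacet Δ G → r ⊆ G → G ≡ F
  clique-star-unique-facet (_ , cliqueBound) {r} {F} {G}
    starClique F-facet r⊆F ∣F∣≡d+1 G-facet r⊆G =
      sym (proj₂ G-facet F (proj₁ F-facet) G⊆F)
    where
      F≡F∪G : F ≡ F ∪ G
      F≡F∪G = ⊆-card-≥⇒≡ (p⊆p∪q G)
        (subst (∣ F ∪ G ∣ ≤_) (sym ∣F∣≡d+1)
          (cliqueBound (F ∪ G) (star-union-is-clique starClique F-facet r⊆F G-facet r⊆G)))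
      G⊆F : G ⊆ F
      G⊆F v∈G = subst (_ ∈_) (sym F≡F∪G) (q⊆p∪q F G v∈G)

  clique-star-ridge-is-free : IsPure Δ → HasDim d (Face Δ) → HasDim d (Cl d Δ) →
    {r : Subset n} → IsRidge d Δ r → IsCliqueP d Δ (StarVertices Δ r) → IsFreeRidge d Δ r
  clique-star-ridge-is-free pure dimΔ dimCl {r} ridge@(r∈Δ , ∣r∣≡d) starClique
    with ridge-in-top-facet pure dimΔ ridge
  ... | F , F-facet , r⊆F , ∣F∣≡d+1 =
    ridge , r∈Δ , F , F-facet , r⊂F ,
    λ G G-facet r⊂G →
      clique-star-unique-facet dimCl starClique F-facet r⊆F ∣F∣≡d+1 G-facet (proj₁ r⊂G)
    where
      r⊂F : r ⊂ F
      r⊂F = ⊆-card-<⇒⊂ r⊆F (subst₂ _<_ (sym ∣r∣≡d) (sym ∣F∣≡d+1) (n<1+n d))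

lemma2p2 : (n d : ℕ) (Δ : Faces n) →
           IsSimplicialComplex Δ → IsPure Δ → HasDim d (Face Δ) →
           RidgeChordalFrom d Δ → HasDim d (Cl d Δ) →
           ∃ λ (r : Subset n) → IsFreeRidge d Δ r
lemma2p2 n d Δ _ pure dimΔ (done allSmall) dimCl =
  ⊥-elim (has-large-face dimΔ allSmall)
lemma2p2 n d Δ _ pure dimΔ (step r ridge starClique _) dimCl =
  r , clique-star-ridge-is-free pure dimΔ dimCl ridge starClique
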